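{- Let $G$ be a finite multigraph and $t$ a positive integer, and assume that every partition $P$ of $V(G)$ satisfies $|{\rm cr}(P,G)|\geq t(|P|-1)$. Then for any partition $P$ of $V(G)$ with $|P|\geq 3$, $$r(G,t)\geq |E(P,G)|+t(|P|-2).$$
   Context: A partition $P$ of $V(G)$ is a partition into nonempty parts; $|P|$ is its number of parts. ${\rm cr}(P,G)$ is the set of edges of $G$ whose end vertices lie in different parts of $P$, and $E(P,G)$ is the set of edges whose two end vertices lie in the same part. An edge-colored graph is rainbow if every edge receives a different color. $r(G,t)$ is the maximum number of colors in an edge-coloring of $G$ that contains no $t$ edge-disjoint rainbow spanning trees. -}

module Defs where

open import Data.Nat using (ℕ; zero; suc; _+_; _*_; _∸_; _≤_)
open import Data.Fin using (Fin; _≟_)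
open import Data.Fin.Subset using (Subset; _∈_; _∉_)
open import Data.List using (List; length; filter)
open import Data.List using () renaming (allFin to allFinL)
open import Data.Product using (Σ; ∃; _×_; _,_; proj₁; proj₂)
open import Data.Sum using (_⊎_)
open import Data.Bool using (false)
open import Data.Vec using (_[_]≔_)
open import Relation.Nullary using (¬_; Dec; ¬?)

open import Relation.Binary.PropositionalEquality using (_≡_; _≢_)

-- A finite multigraph: vertices Fin n, edges Fin m, each edge has two
-- end vertices (parallel edges and loops allowed).
record Multigraph : Set where
  field
    n    : ℕ
    m    : ℕ
    ends : Fin m → Fin n × Fin n

open Multigraph public

end₁ : (G : Multigraph) → Fin (m G) → Fin (n G)
end₁ G e = proj₁ (ends G e)

end₂ : (G : Multigraph) → Fin (m G) → Fin (n G)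
end₂ G e = proj₂ (ends G e)

Surj : {A B : Set} → (A → B) → Set
Surj {A} {B} f = ∀ (y : B) → Σ A (λ x → f x ≡ y)

-- A partition of V(G) into k nonempty parts: a surjection V(G) → Fin k
-- (part labels); |P| = k.
Partition : Multigraph → ℕ → Set
Partition G k = Σ (Fin (n G) → Fin k) Surj

Crossing : (G : Multigraph) {k : ℕ} → (Fin (n G) → Fin k) → Fin (m G) → Set
Crossing G p e = p (end₁ G e) ≢ p (end₂ G e)

crossing? : (G : Multigraph) {k : ℕ} (p : Fin (n G) → Fin k) (e : Fin (m G)) →
            Dec (Crossing G p e)
crossing? G p e = ¬? (p (end₁ G e) ≟ p (end₂ G e))

inside? : (G : Multigraph) {k : ℕ} (p : Fin (n G) → Fin k) (e : Fin (m G)) →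
          Dec (p (end₁ G e) ≡ p (end₂ G e))
inside? G p e = p (end₁ G e) ≟ p (end₂ G e)

crSize : (G : Multigraph) {k : ℕ} → (Fin (n G) → Fin k) → ℕ
crSize G p = length (filter (crossing? G p) (allFinL (m G)))

inSize : (G : Multigraph) {k : ℕ} → (Fin (n G) → Fin k) → ℕ
inSize G p = length (filter (inside? G p) (allFinL (m G)))

data Reach (G : Multigraph) (T : Subset (m G)) : Fin (n G) → Fin (n G) → Set where
  here : ∀ {u} → Reach G T u u
  step : ∀ {u w} (e : Fin (m G)) → e ∈ T →
         ((end₁ G e ≡ u × end₂ G e ≡ w) ⊎ (end₂ G e ≡ u × end₁ G e ≡ w)) →
         ∀ {v} → Reach G T w v → Reach G T u v

Connected : (G : Multigraph) → Subset (m G) → Set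
Connected G T = ∀ (u v : Fin (n G)) → Reach G T u v

_without_ : {m : ℕ} → Subset m → Fin m → Subset m
T without e = T [ e ]≔ false

-- Acyclic: no edge of T lies on a cycle of T, i.e. for no edge e ∈ T are
-- its ends joined by a path in T - e (a loop e counts as a cycle).
Acyclic : (G : Multigraph) → Subset (m G) → Set
Acyclic G T = ∀ (e : Fin (m G)) → e ∈ T → ¬ Reach G (T without e) (end₁ G e) (end₂ G e)

SpanningTree : (G : Multigraph) → Subset (m G) → Set
SpanningTree G T = Connected G T × Acyclic G T

Rainbow : (G : Multigraph) {q : ℕ} → (Fin (m G) → Fin q) → Subset (m G) → Set
Rainbow G c T = ∀ (e f : Fin (m G)) → e ∈ T → f ∈ T → e ≢ f → c e ≢ c f

HasDisjointRainbowTrees : (G : Multigraph) {q : ℕ} → (Fin (m G) → Fin q) → ℕ → Set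
HasDisjointRainbowTrees G c t =
  Σ (Fin t → Subset (m G)) λ Ts →
    (∀ i → SpanningTree G (Ts i) × Rainbow G c (Ts i)) ×
    (∀ i j → i ≢ j → ∀ (e : Fin (m G)) → e ∈ Ts i → e ∉ Ts j)

-- r(G,t) ≥ b : some edge-colouring using exactly q ≥ b colours
-- (c : E(G) → Fin q surjective) has no t edge-disjoint rainbow spanning trees.
rAtLeast : Multigraph → ℕ → ℕ → Set
rAtLeast G t b = Σ ℕ λ q → Σ (Fin (m G) → Fin q) λ c →
  Surj c × b ≤ q × ¬ HasDisjointRainbowTrees G c t

-- Colour the edges inside the parts of P with pairwise distinct colours, give the
-- first s := t(|P|-2) - 1 crossing edges further distinct colours, and paint all
-- remaining crossing edges with one last colour; by the hypothesis on cr(P,G) every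
-- colour is used, so there are |E(P,G)| + t(|P|-2) colours. A spanning tree has at
-- least |P| - 1 crossing edges, and a rainbow one uses the last colour at most once,
-- so t edge-disjoint rainbow spanning trees would contain t(|P|-1) distinct crossing
-- edges among the s edges of private colour and at most t edges of the shared one;
-- but s + t < t(|P|-1).
module Submission where

open import Defs
open import Data.Nat using (ℕ; zero; suc; _+_; _*_; _∸_; _≤_; _<_; z≤n; s≤s; _<?_)
open import Data.Nat.Properties
  using (≤-refl; ≤-trans; ≤-reflexive; <-trans; n≤1+n; m≤n⇒m≤1+n; <⇒≱; ∸-monoˡ-≤;
         *-monoʳ-≤; *-suc; +-comm)
open import Data.Fin
  using (Fin; zero; suc; toℕ; fromℕ<; inject≤; punchIn; punchOut; _↑ˡ_; _↑ʳ_;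
         splitAt; join; combine; remQuot)
  renaming (_≟_ to _≟ᶠ_)
open import Data.Fin.Properties
  using (toℕ-injective; toℕ-fromℕ<; toℕ<n; suc-injective; inject≤-injective;
         punchOut-cong; punchOut-punchIn; punchInᵢ≢i; splitAt-join; splitAt⁻¹-↑ˡ;
         splitAt⁻¹-↑ʳ; combine-remQuot; injective⇒≤)
open import Data.Fin.Subset using (Subset) renaming (_∈_ to _∈ₛ_; _∉_ to _∉ₛ_)
open import Data.Fin.Subset.Properties using () renaming (_∈?_ to _∈ₛ?_)
open import Data.List using (List; []; _∷_; length; filter; lookup; allFin)
open import Data.List.Membership.Propositional using (_∈_)
open import Data.List.Membership.Propositional.Properties
  using (∈-filter⁺; ∈-filter⁻; ∈-allFin; ∈-lookup)
open import Data.List.Membership.Propositional.Properties.WithK using (unique⇒irrelevant)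
open import Data.List.Relation.Unary.Any using (here; there; index)
open import Data.List.Relation.Unary.Any.Properties using (lookup-index)
open import Data.List.Relation.Unary.Unique.Propositional using (Unique)
import Data.List.Relation.Unary.Unique.Propositional.Properties as Unique
open import Data.Product using (_×_; _,_; proj₁; proj₂; uncurry)
open import Data.Sum using (_⊎_; inj₁; inj₂)
open import Data.Sum.Properties using (inj₁-injective; inj₂-injective)
open import Function using (_∘_)
open import Function.Definitions using (Injective)
open import Level using (0ℓ)
open import Relation.Nullary using (yes; no; contradiction)
open import Relation.Nullary.Decidable using (_×-dec_; decidable-stable)
open import Relation.Unary using (Pred; Decidable)
open import Relation.Binary.PropositionalEquality
  using (_≡_; _≢_; refl; sym; trans; cong; subst; module ≡-Reasoning)

index-∈-lookup : ∀ {A : Set} (xs : List A) i → index (∈-lookup {xs = xs} i) ≡ i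
index-∈-lookup (x ∷ xs) zero    = refl
index-∈-lookup (x ∷ xs) (suc i) = cong suc (index-∈-lookup xs i)

module Enumeration {m : ℕ} {P : Pred (Fin m) 0ℓ} (P? : Decidable P) where

  members : List (Fin m)
  members = filter P? (allFin m)

  members-unique : Unique members
  members-unique = Unique.filter⁺ P? (Unique.allFin⁺ m)

  member : Fin (length members) → Fin m
  member = lookup members

  member-satisfies : ∀ i → P (member i)
  member-satisfies i = proj₂ (∈-filter⁻ P? {xs = allFin m} (∈-lookup i))

  ∈members : ∀ {e} → P e → e ∈ members
  ∈members pe = ∈-filter⁺ P? (∈-allFin _) pe

  position : ∀ e → P e → Fin (length members)
  position e pe = index (∈members pe)

  member-position : ∀ e (pe : P e) → member (position e pe) ≡ e
  member-position e pe = sym (lookup-index (∈members pe))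

  position-cong : ∀ {e f} (pe : P e) (pf : P f) → e ≡ f → position e pe ≡ position f pf
  position-cong pe pf refl = cong index (unique⇒irrelevant members-unique _ _)

  position-member : ∀ i (pe : P (member i)) → position (member i) pe ≡ i
  position-member i pe = begin
    index (∈members pe)               ≡⟨ cong index (unique⇒irrelevant members-unique _ _) ⟩
    index (∈-lookup {xs = members} i) ≡⟨ index-∈-lookup members i ⟩
    i                                 ∎
    where open ≡-Reasoning

  position-injective : ∀ {e f} (pe : P e) (pf : P f) → position e pe ≡ position f pf → e ≡ f
  position-injective {e} {f} pe pf eq = begin
    e                      ≡⟨ sym (member-position e pe) ⟩
    member (position e pe) ≡⟨ cong member eq ⟩
    member (position f pf) ≡⟨ member-position f pf ⟩
    f                      ∎
    where open ≡-Reasoning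

  member-injective : ∀ {i j} → member i ≡ member j → i ≡ j
  member-injective {i} {j} eq = begin
    i                      ≡⟨ sym (position-member i pi) ⟩
    position (member i) pi ≡⟨ position-cong pi pj eq ⟩
    position (member j) pj ≡⟨ position-member j pj ⟩
    j                      ∎
    where
    open ≡-Reasoning
    pi = member-satisfies i
    pj = member-satisfies j

injective⇒*≤+ : ∀ {a b c d} {f : Fin a × Fin b → Fin c ⊎ Fin d} →
                Injective _≡_ _≡_ f → a * b ≤ c + d
injective⇒*≤+ {a} {b} {c} {d} {f} f-injective =
  injective⇒≤ {f = join c d ∘ f ∘ remQuot {a} b} λ {x} {y} eq → begin
    x                                 ≡⟨ sym (combine-remQuot {a} b x) ⟩
    uncurry combine (remQuot {a} b x) ≡⟨ cong (uncurry combine) (f-injective (join-injective eq)) ⟩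
    uncurry combine (remQuot {a} b y) ≡⟨ combine-remQuot {a} b y ⟩
    y                                 ∎
  where
  open ≡-Reasoning
  join-injective : ∀ {u v} → join c d u ≡ join c d v → u ≡ v
  join-injective {u} {v} eq =
    trans (sym (splitAt-join c d u)) (trans (cong (splitAt c) eq) (splitAt-join c d v))

clamp : ∀ {N} (s : ℕ) → Fin N → Fin (suc s)
clamp s j with toℕ j <? s
... | yes j<s = suc (fromℕ< j<s)
... | no _    = zero

clamp-toℕ : ∀ {N s} {j : Fin N} {x} → clamp s j ≡ suc x → toℕ j ≡ toℕ x
clamp-toℕ {s = s} {j} eq with toℕ j <? s
clamp-toℕ eq | yes j<s = trans (sym (toℕ-fromℕ< j<s)) (cong toℕ (suc-injective eq))
clamp-toℕ () | no _

clamp-injective : ∀ {N s} {i j : Fin N} {x} → clamp s i ≡ suc x → clamp s j ≡ suc x → i ≡ j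
clamp-injective ci cj = toℕ-injective (trans (clamp-toℕ ci) (sym (clamp-toℕ cj)))

clamp-< : ∀ {N s} {j : Fin N} (j<s : toℕ j < s) → clamp s j ≡ suc (fromℕ< j<s)
clamp-< {s = s} {j} j<s with toℕ j <? s
... | yes _  = refl
... | no j≮s = contradiction j<s j≮s

clamp-≥ : ∀ {N s} {j : Fin N} → s ≤ toℕ j → clamp s j ≡ zero
clamp-≥ {s = s} {j} s≤j with toℕ j <? s
... | yes j<s = contradiction s≤j (<⇒≱ j<s)
... | no _    = refl

clamp-surjective : ∀ {N} s → s < N → Surj (clamp {N} s)
clamp-surjective s s<N zero = fromℕ< s<N , clamp-≥ (≤-reflexive (sym (toℕ-fromℕ< s<N)))
clamp-surjective s s<N (suc x) = j , trans (clamp-< j<s) (cong suc (toℕ-injective toℕ-j≡x))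
  where
  j = fromℕ< (<-trans (toℕ<n x) s<N)
  j<s : toℕ j < s
  j<s = subst (_< s) (sym (toℕ-fromℕ< _)) (toℕ<n x)
  toℕ-j≡x : toℕ (fromℕ< j<s) ≡ toℕ x
  toℕ-j≡x = trans (toℕ-fromℕ< j<s) (toℕ-fromℕ< _)

merge : ∀ {k} {a b : Fin (suc k)} → a ≢ b → Fin (suc k) → Fin k
merge {b = b} a≢b x with b ≟ᶠ x
... | yes _   = punchOut (a≢b ∘ sym)
... | no  b≢x = punchOut b≢x

merge-identifies : ∀ {k} {a b : Fin (suc k)} (a≢b : a ≢ b) → merge a≢b a ≡ merge a≢b b
merge-identifies {a = a} {b} a≢b with b ≟ᶠ a | b ≟ᶠ b
... | yes _ | yes _   = refl
... | no  _ | yes _   = punchOut-cong b refl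
... | _     | no  b≢b = contradiction refl b≢b

merge-punchIn : ∀ {k} {a b : Fin (suc k)} (a≢b : a ≢ b) y → merge a≢b (punchIn b y) ≡ y
merge-punchIn {b = b} a≢b y with b ≟ᶠ punchIn b y
... | yes b≡y = contradiction (sym b≡y) (punchInᵢ≢i b y)
... | no  _   = trans (punchOut-cong b refl) (punchOut-punchIn b)

module _ (G : Multigraph) (T : Subset (m G)) where

  Reach⇒samePart : ∀ {k} (p : Fin (n G) → Fin k) →
                   (∀ f → f ∈ₛ T → p (end₁ G f) ≡ p (end₂ G f)) →
                   ∀ {u v} → Reach G T u v → p u ≡ p v
  Reach⇒samePart p inside here = refl
  Reach⇒samePart p inside (step e e∈T (inj₁ (refl , refl)) r) =
    trans (inside e e∈T) (Reach⇒samePart p inside r)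
  Reach⇒samePart p inside (step e e∈T (inj₂ (refl , refl)) r) =
    trans (sym (inside e e∈T)) (Reach⇒samePart p inside r)

  -- Each edge of L that crosses the partition lets two parts be merged.
  connected⇒parts≤1+crossings : Connected G T → ∀ L {k} (p : Fin (n G) → Fin k) → Surj p →
                                (∀ f → f ∈ₛ T → Crossing G p f → f ∈ L) → k ≤ suc (length L)
  connected⇒parts≤1+crossings con [] {zero}        p p-surjective covered = z≤n
  connected⇒parts≤1+crossings con [] {suc zero}    p p-surjective covered = s≤s z≤n
  connected⇒parts≤1+crossings con [] {suc (suc k)} p p-surjective covered =
    contradiction (trans (sym pu≡0) (trans (Reach⇒samePart p inside (con u v)) pv≡1)) λ ()
    where
    u = proj₁ (p-surjective zero)
    pu≡0 = proj₂ (p-surjective zero)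
    v = proj₁ (p-surjective (suc zero))
    pv≡1 = proj₂ (p-surjective (suc zero))
    inside : ∀ f → f ∈ₛ T → p (end₁ G f) ≡ p (end₂ G f)
    inside f f∈T = decidable-stable (inside? G p f) λ cr → contradiction (covered f f∈T cr) λ ()
  connected⇒parts≤1+crossings con (e ∷ L) {zero} p p-surjective covered =
    contradiction (p (end₁ G e)) λ ()
  connected⇒parts≤1+crossings con (e ∷ L) {suc k} p p-surjective covered with inside? G p e
  ... | yes e-inside =
    m≤n⇒m≤1+n (connected⇒parts≤1+crossings con L p p-surjective covered′)
    where
    covered′ : ∀ f → f ∈ₛ T → Crossing G p f → f ∈ L
    covered′ f f∈T cr with covered f f∈T cr
    ... | here refl = contradiction e-inside cr
    ... | there f∈L = f∈L
  ... | no e-crossing =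
    s≤s (connected⇒parts≤1+crossings con L p′ p′-surjective covered′)
    where
    p′ : Fin (n G) → Fin k
    p′ = merge e-crossing ∘ p
    p′-surjective : Surj p′
    p′-surjective y with p-surjective (punchIn (p (end₂ G e)) y)
    ... | v , pv = v , trans (cong (merge e-crossing) pv) (merge-punchIn e-crossing y)
    covered′ : ∀ f → f ∈ₛ T → Crossing G p′ f → f ∈ L
    covered′ f f∈T cr′ with covered f f∈T (cr′ ∘ cong (merge e-crossing))
    ... | here refl = contradiction (merge-identifies e-crossing) cr′
    ... | there f∈L = f∈L

rainbow-injective : ∀ {G q} {c : Fin (m G) → Fin q} {T} → Rainbow G c T →
                    ∀ {e f} → e ∈ₛ T → f ∈ₛ T → c e ≡ c f → e ≡ f
rainbow-injective rainbow {e} {f} e∈T f∈T ce≡cf =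
  decidable-stable (e ≟ᶠ f) λ e≢f → rainbow e f e∈T f∈T e≢f ce≡cf

module CappedColouring (G : Multigraph) {k : ℕ} (p : Fin (n G) → Fin k) (s : ℕ) where

  private
    module Inside = Enumeration (inside? G p)
    module Cross  = Enumeration (crossing? G p)

  crossingClass : ∀ e → Crossing G p e → Fin (suc s)
  crossingClass e cr = clamp s (Cross.position e cr)

  colour : Fin (m G) → Fin (inSize G p + suc s)
  colour e with inside? G p e
  ... | yes ins = Inside.position e ins ↑ˡ suc s
  ... | no  cr  = inSize G p ↑ʳ crossingClass e cr

  colour-inside : ∀ e (ins : p (end₁ G e) ≡ p (end₂ G e)) →
                  colour e ≡ Inside.position e ins ↑ˡ suc s
  colour-inside e ins with inside? G p e
  ... | yes ins′ = cong (_↑ˡ suc s) (Inside.position-cong ins′ ins refl)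
  ... | no  cr   = contradiction ins cr

  colour-crossing : ∀ e (cr : Crossing G p e) → colour e ≡ inSize G p ↑ʳ crossingClass e cr
  colour-crossing e cr with inside? G p e
  ... | yes ins = contradiction ins cr
  ... | no  cr′ = cong (λ j → inSize G p ↑ʳ clamp s j) (Cross.position-cong cr′ cr refl)

  colour-member-inside : ∀ i → colour (Inside.member i) ≡ i ↑ˡ suc s
  colour-member-inside i = trans (colour-inside _ ins)
    (cong (_↑ˡ suc s) (Inside.position-member i ins))
    where ins = Inside.member-satisfies i

  colour-member-crossing : ∀ j → colour (Cross.member j) ≡ inSize G p ↑ʳ clamp s j
  colour-member-crossing j = trans (colour-crossing _ cr)
    (cong (λ i → inSize G p ↑ʳ clamp s i) (Cross.position-member j cr))
    where cr = Cross.member-satisfies j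

  colour-surjective : s < crSize G p → Surj colour
  colour-surjective s<crossings y with splitAt (inSize G p) y in split
  ... | inj₁ i = Inside.member i , trans (colour-member-inside i) (splitAt⁻¹-↑ˡ split)
  ... | inj₂ x with clamp-surjective s s<crossings x
  ...   | j , clamp-j≡x = Cross.member j , (begin
    colour (Cross.member j)  ≡⟨ colour-member-crossing j ⟩
    inSize G p ↑ʳ clamp s j  ≡⟨ cong (inSize G p ↑ʳ_) clamp-j≡x ⟩
    inSize G p ↑ʳ x          ≡⟨ splitAt⁻¹-↑ʳ split ⟩
    y                        ∎)
    where open ≡-Reasoning

  module DisjointRainbowTrees
    (p-surjective : Surj p) {t : ℕ} (Ts : Fin t → Subset (m G))
    (trees : ∀ i → SpanningTree G (Ts i) × Rainbow G colour (Ts i))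
    (disjoint : ∀ i j → i ≢ j → ∀ e → e ∈ₛ Ts i → e ∉ₛ Ts j) where

    module TreeCrossings (i : Fin t) = Enumeration (λ e → (e ∈ₛ? Ts i) ×-dec crossing? G p e)

    enough-crossings : ∀ i → k ∸ 1 ≤ length (TreeCrossings.members i)
    enough-crossings i = ∸-monoˡ-≤ 1
      (connected⇒parts≤1+crossings G (Ts i) (proj₁ (proj₁ (trees i))) (TreeCrossings.members i) p
        p-surjective (λ f f∈T cr → TreeCrossings.∈members i (f∈T , cr)))

    crossingEdge : Fin t → Fin (k ∸ 1) → Fin (m G)
    crossingEdge i a = TreeCrossings.member i (inject≤ a (enough-crossings i))

    crossingEdge-in-tree : ∀ i a → crossingEdge i a ∈ₛ Ts i
    crossingEdge-in-tree i a = proj₁ (TreeCrossings.member-satisfies i _)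

    crossingEdge-crosses : ∀ i a → Crossing G p (crossingEdge i a)
    crossingEdge-crosses i a = proj₂ (TreeCrossings.member-satisfies i _)

    crossingEdge-injective : ∀ {i a i′ a′} → crossingEdge i a ≡ crossingEdge i′ a′ → (i , a) ≡ (i′ , a′)
    crossingEdge-injective {i} {a} {i′} {a′} eq
      with decidable-stable (i ≟ᶠ i′)
             (λ i≢i′ → disjoint i i′ i≢i′ _ (crossingEdge-in-tree i a)
                         (subst (_∈ₛ Ts i′) (sym eq) (crossingEdge-in-tree i′ a′)))
    ... | refl = cong (i ,_) (inject≤-injective _ _ a a′ (TreeCrossings.member-injective i eq))

    class : Fin t → Fin (k ∸ 1) → Fin (suc s)
    class i a = crossingClass (crossingEdge i a) (crossingEdge-crosses i a)

    -- Class zero is shared, so there the tree index keeps tokens apart.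
    spill : Fin t → Fin (suc s) → Fin s ⊎ Fin t
    spill i zero    = inj₂ i
    spill i (suc x) = inj₁ x

    token : Fin t × Fin (k ∸ 1) → Fin s ⊎ Fin t
    token (i , a) = spill i (class i a)

    token-injective : Injective _≡_ _≡_ token
    token-injective {i , a} {i′ , a′} eq with class i a in ca | class i′ a′ in ca′
    token-injective {i , a} {i′ , a′} eq | zero | zero with inj₂-injective eq
    ... | refl = crossingEdge-injective (rainbow-injective {G} (proj₂ (trees i))
                   (crossingEdge-in-tree i a) (crossingEdge-in-tree i a′) (begin
      colour (crossingEdge i a)        ≡⟨ colour-crossing _ (crossingEdge-crosses i a) ⟩
      inSize G p ↑ʳ class i a  ≡⟨ cong (inSize G p ↑ʳ_) (trans ca (sym ca′)) ⟩
      inSize G p ↑ʳ class i a′ ≡⟨ colour-crossing _ (crossingEdge-crosses i a′) ⟨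
      colour (crossingEdge i a′)       ∎))
      where open ≡-Reasoning
    token-injective {i , a} {i′ , a′} eq | suc x | suc x′ with inj₁-injective eq
    ... | refl = crossingEdge-injective (Cross.position-injective _ _ (clamp-injective ca ca′))
    token-injective () | zero | suc _
    token-injective () | suc _ | zero

  disjointRainbowTrees⇒≤ : Surj p → ∀ {t} → HasDisjointRainbowTrees G colour t →
                           t * (k ∸ 1) ≤ s + t
  disjointRainbowTrees⇒≤ p-surjective (Ts , trees , disjoint) =
    injective⇒*≤+ (DisjointRainbowTrees.token-injective p-surjective Ts trees disjoint)

lemma1 : (G : Multigraph) (t : ℕ) → 1 ≤ t →
         (∀ (k : ℕ) (P : Partition G k) → t * (k ∸ 1) ≤ crSize G (proj₁ P)) →
         ∀ (k : ℕ) (P : Partition G k) → 3 ≤ k →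
         rAtLeast G t (inSize G (proj₁ P) + t * (k ∸ 2))
lemma1 G (suc t₀) (s≤s z≤n) crossing-bound (suc (suc (suc k₀))) P@(p , p-surjective)
       (s≤s (s≤s (s≤s z≤n))) =
  inSize G p + suc s , colour , colour-surjective s<crossings , ≤-refl ,
  λ trees → <⇒≱ too-few-edges (disjointRainbowTrees⇒≤ p-surjective trees)
  where
  t = suc t₀
  -- Chosen so that suc s reduces to t * (k ∸ 2).
  s = k₀ + t₀ * suc k₀
  open CappedColouring G p s
  s<crossings : s < crSize G p
  s<crossings = ≤-trans (*-monoʳ-≤ t (n≤1+n (suc k₀))) (crossing-bound _ P)
  too-few-edges : s + t < t * suc (suc k₀)
  too-few-edges = ≤-reflexive (trans (+-comm (suc s) t) (sym (*-suc t (suc k₀))))
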